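{- Let $G$ be a simple graph, fix $P\in V(G)$, let $G_1,\dots,G_m$ be the connected components of the graph $G-P$, and let $\deg_{G_i}P$ be the number of edges of $G$ joining $P$ to a vertex of $G_i$. Then \[m(H_f(P))=\min\{\deg_{G_i}P: i\in\{1,\dots,m\}\}.\]
   Context: A graph is a finite connected multigraph with no loop edges; a simple graph is a graph with no multiple edges and more than one vertex. $G-P$ is obtained from $G$ by deleting $P$ and its incident edges. $\mathbb{N}=\{0,1,2,\dots\}$. For $f:V(G)\to\mathbb{Z}$, $\Delta f(Q)=\sum_{e=QR\in E(G)}(f(Q)-f(R))$. $H_f(P)=\{n\in\mathbb{N}:\exists f:V(G)\to\mathbb{Z}\text{ with }\Delta f(P)=-n\text{ and }\Delta f(Q)\ge 0\ \forall Q\neq P\}$ (a numerical semigroup when $G$ is simple). For a numerical semigroup $S$, its multiplicity is $m(S)=\min(S\setminus\{0\})$. -}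

module Defs where

open import Data.Nat using (ℕ; zero; suc; _≤_)
open import Data.Integer as ℤ using (ℤ; +_; 0ℤ; _-_; -_)
open import Data.Fin using (Fin)
open import Data.Bool using (Bool; true; false; T; if_then_else_)
open import Data.List using (List; length; map; foldr; allFin)
open import Data.List.Membership.Propositional using (_∈_)
open import Data.List.Relation.Unary.Unique.Propositional using (Unique)
open import Data.Product using (Σ; ∃; _×_; _,_)
open import Function.Bundles using (_⇔_)
open import Relation.Binary.PropositionalEquality using (_≡_; _≢_)

data Walk {n : ℕ} (adj : Fin n → Fin n → Bool) : Fin n → Fin n → Set where
  here : ∀ {i} → Walk adj i i
  step : ∀ {i j k} → T (adj i j) → Walk adj j k → Walk adj i k

record SimpleGraph (n : ℕ) : Set where
  field
    adj       : Fin n → Fin n → Bool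
    adj-sym   : ∀ i j → adj i j ≡ adj j i
    adj-irr   : ∀ i → adj i i ≡ false
    connected : ∀ i j → Walk adj i j
open SimpleGraph public

data WalkAvoid {n : ℕ} (G : SimpleGraph n) (P : Fin n) : Fin n → Fin n → Set where
  here : ∀ {i} → i ≢ P → WalkAvoid G P i i
  step : ∀ {i j k} → i ≢ P → T (adj G i j) → WalkAvoid G P j k → WalkAvoid G P i k

sumℤ : List ℤ → ℤ
sumℤ = foldr ℤ._+_ 0ℤ

Δ : ∀ {n} → SimpleGraph n → (Fin n → ℤ) → Fin n → ℤ
Δ G f Q = sumℤ (map (λ R → if adj G Q R then f Q - f R else 0ℤ) (allFin _))

H : ∀ {n} → SimpleGraph n → Fin n → ℕ → Set
H {n} G P k = Σ (Fin n → ℤ) λ f → (Δ G f P ≡ - (+ k)) × (∀ Q → Q ≢ P → 0ℤ ℤ.≤ Δ G f Q)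

IsMultiplicity : (ℕ → Set) → ℕ → Set
IsMultiplicity S m = S m × m ≢ 0 × (∀ k → S k → k ≢ 0 → m ≤ k)

IsCount : ∀ {n} → (Fin n → Set) → ℕ → Set
IsCount {n} A d = Σ (List (Fin n)) λ xs → length xs ≡ d × Unique xs × (∀ R → (R ∈ xs) ⇔ A R)

-- deg_{G_i} P where G_i is the component of G - P containing Q (Q ≠ P):
-- number of edges joining P to a vertex of that component
CompDeg : ∀ {n} → SimpleGraph n → Fin n → Fin n → ℕ → Set
CompDeg G P Q d = IsCount (λ R → T (adj G P R) × WalkAvoid G P Q R) d

IsMinCompDeg : ∀ {n} → SimpleGraph n → Fin n → ℕ → Set
IsMinCompDeg {n} G P d =
  (Σ (Fin n) λ Q → Q ≢ P × CompDeg G P Q d) ×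
  (∀ Q e → Q ≢ P → CompDeg G P Q e → d ≤ e)

module Submission where

-- If Q ≠ P, the indicator function of the component of Q in G − P has Laplacian
-- −deg_{G_i} P at P and is nonnegative elsewhere, so every deg_{G_i} P lies in H_f(P).
-- Conversely, let Δf(P) < 0 and Δf ≥ 0 off P.  A minimum of f away from P is shared
-- by all its neighbours, so following a walk to P shows that f is minimal at P.  Some
-- neighbour R₀ of P has f R₀ > f P, and then f > f P on the whole component of R₀ (a
-- vertex there with value f P would pass it back to R₀), so each neighbour of P in
-- that component contributes at most −1 to Δf(P).

open import Defs
open import Level using (Level)
open import Data.Nat as ℕ using (ℕ; zero; suc; _≤_; _<_; z≤n; s≤s)
import Data.Nat.Properties as ℕ
open import Data.Integer as ℤ using (ℤ; +_; 0ℤ; -1ℤ; -_; +≤+; -<+)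
import Data.Integer.Properties as ℤ
open import Data.Fin using (Fin; zero; suc)
open import Data.Fin.Properties using (_≟_; any?)
open import Data.Fin.Subset as Subset using (Subset; ⁅_⁆; _∪_; _⊂_; ∣_∣)
open import Data.Fin.Subset.Properties
  using (_∈?_; _⊂?_; x∈⁅x⁆; x∈⁅y⁆⇒x≡y; ∣⁅x⁆∣≡1; ∣p∣≤n; p⊆p∪q; x∈p∪q⁺; x∈p∪q⁻; p⊂q⇒∣p∣<∣q∣)
open import Data.Bool using (true; false; T; if_then_else_)
open import Data.Unit using (tt)
open import Data.List using (List; []; _∷_; length; map; filter; allFin)
open import Data.List.Membership.Propositional using (_∈_)
open import Data.List.Membership.Propositional.Properties using (∈-allFin; ∈-filter⁺; ∈-filter⁻)
open import Data.List.Membership.Propositional.Properties.WithK using (unique∧set⇒bag)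
import Data.List.Relation.Unary.All as All
open import Data.List.Relation.Unary.Unique.Propositional.Properties using (allFin⁺; filter⁺)
open import Data.List.Relation.Binary.BagAndSetEquality using (∼bag⇒↭)
open import Data.List.Relation.Binary.Permutation.Propositional.Properties using (↭-length)
import Data.List.Extrema
open import Data.Product using (Σ; ∃; _×_; _,_; proj₂; uncurry)
open import Data.Sum using (_⊎_; inj₁; inj₂)
open import Data.Vec using (tabulate)
open import Data.Vec.Properties using (lookup⇒[]=; []=⇒lookup; lookup∘tabulate)
open import Function using (_∘_)
open import Function.Bundles using (mk⇔; Equivalence)
open import Relation.Binary using (Rel; Decidable)
open import Relation.Binary.Construct.Closure.ReflexiveTransitive using (Star; ε; _◅_; _◅◅_)
open import Relation.Binary.PropositionalEquality
  using (_≡_; _≢_; refl; sym; trans; cong; cong₂; subst)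
open import Relation.Nullary using (¬_; Dec; yes; no; does; contradiction; ¬?)
open import Relation.Nullary.Decidable using (map′; _×-dec_)
open import Relation.Nullary.Decidable.Core using (T?)
open import Relation.Unary using (Pred)
import Relation.Unary as U

private
  variable
    a ℓ : Level
    A : Set a
    n : ℕ

toSubset : {P : Pred (Fin n) ℓ} → U.Decidable P → Subset n
toSubset P? = tabulate (does ∘ P?)

module _ {P : Pred (Fin n) ℓ} (P? : U.Decidable P) where

  ∈-toSubset⁺ : ∀ {x} → P x → x Subset.∈ toSubset P?
  ∈-toSubset⁺ {x} px with P? x in eq
  ... | yes _ = lookup⇒[]= x _ (trans (lookup∘tabulate (does ∘ P?) x) (cong does eq))
  ... | no ¬px = contradiction px ¬px

  ∈-toSubset⁻ : ∀ {x} → x Subset.∈ toSubset P? → P x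
  ∈-toSubset⁻ {x} x∈ with P? x | trans (sym (lookup∘tabulate (does ∘ P?) x)) ([]=⇒lookup x∈)
  ... | yes px | _ = px
  ... | no _ | ()

module Reachability {_⟶_ : Rel (Fin n) ℓ} (_⟶?_ : Decidable _⟶_) where

  successor? : ∀ S → U.Decidable (λ y → ∃ λ x → x Subset.∈ S × x ⟶ y)
  successor? S y = any? (λ x → x ∈? S ×-dec x ⟶? y)

  successors : Subset n → Subset n
  successors S = toSubset (successor? S)

  expand : Subset n → Subset n
  expand S = S ∪ successors S

  Closed : Subset n → Set ℓ
  Closed S = ∀ {x y} → x Subset.∈ S → x ⟶ y → y Subset.∈ S

  closed⇒expand⊆ : ∀ {S} → Closed S → ∀ {x} → x Subset.∈ expand S → x Subset.∈ S
  closed⇒expand⊆ {S} closed x∈ with x∈p∪q⁻ S (successors S) x∈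
  ... | inj₁ x∈S = x∈S
  ... | inj₂ x∈succ with ∈-toSubset⁻ (successor? S) x∈succ
  ...   | _ , z∈S , z⟶x = closed z∈S z⟶x

  expand-closed : ∀ {S} → Closed S → Closed (expand S)
  expand-closed closed x∈ x⟶y = p⊆p∪q _ (closed (closed⇒expand⊆ closed x∈) x⟶y)

  ⊄expand⇒closed : ∀ {S} → ¬ (S ⊂ expand S) → Closed S
  ⊄expand⇒closed {S} S⊄ {x} {y} x∈S x⟶y with y ∈? S
  ... | yes y∈S = y∈S
  ... | no y∉S = contradiction ((λ {_} → p⊆p∪q _) , y , y∈expand , y∉S) S⊄
    where y∈expand = x∈p∪q⁺ (inj₂ (∈-toSubset⁺ (successor? S) (x , x∈S , x⟶y)))

  layer : Fin n → ℕ → Subset n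
  layer x zero = ⁅ x ⁆
  layer x (suc k) = expand (layer x k)

  start∈layer : ∀ x k → x Subset.∈ layer x k
  start∈layer x zero = x∈⁅x⁆ x
  start∈layer x (suc k) = p⊆p∪q _ (start∈layer x k)

  layer-sound : ∀ {x y} k → y Subset.∈ layer x k → Star _⟶_ x y
  layer-sound {x} zero y∈ rewrite x∈⁅y⁆⇒x≡y x y∈ = ε
  layer-sound {x} (suc k) y∈ with x∈p∪q⁻ (layer x k) _ y∈
  ... | inj₁ y∈ₖ = layer-sound k y∈ₖ
  ... | inj₂ y∈succ with ∈-toSubset⁻ (successor? (layer x k)) y∈succ
  ...   | z , z∈ₖ , z⟶y = layer-sound k z∈ₖ ◅◅ (z⟶y ◅ ε)

  layer-growth : ∀ x k → Closed (layer x k) ⊎ k < ∣ layer x k ∣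
  layer-growth x zero = inj₂ (ℕ.≤-reflexive (sym (∣⁅x⁆∣≡1 x)))
  layer-growth x (suc k) with layer x k ⊂? layer x (suc k) | layer-growth x k
  ... | no ⊄     | _          = inj₁ (expand-closed (⊄expand⇒closed ⊄))
  ... | yes _    | inj₁ closed = inj₁ (expand-closed closed)
  ... | yes ⊂next | inj₂ k<∣∣  = inj₂ (ℕ.<-≤-trans (s≤s k<∣∣) (p⊂q⇒∣p∣<∣q∣ ⊂next))

  layer-closed : ∀ x → Closed (layer x n)
  layer-closed x with layer-growth x n
  ... | inj₁ closed = closed
  ... | inj₂ n<∣∣ = contradiction (∣p∣≤n (layer x n)) (ℕ.<⇒≱ n<∣∣)

  closed-star : ∀ {S x y} → Closed S → x Subset.∈ S → Star _⟶_ x y → y Subset.∈ S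
  closed-star closed x∈ ε = x∈
  closed-star closed x∈ (x⟶z ◅ z⟶⋆y) = closed-star closed (closed x∈ x⟶z) z⟶⋆y

  star? : Decidable (Star _⟶_)
  star? x y = map′ (layer-sound n) (closed-star (layer-closed x) (start∈layer x n)) (y ∈? layer x n)

filter-nonempty : ∀ {P : Pred A ℓ} (P? : U.Decidable P) {x xs} → x ∈ xs → P x →
                  0 < length (filter P? xs)
filter-nonempty P? {xs = xs} x∈ px with filter P? xs | ∈-filter⁺ P? x∈ px
... | _ ∷ _ | _ = s≤s z≤n

IsCount-functional : ∀ {P : Fin n → Set} {d e} → IsCount P d → IsCount P e → d ≡ e
IsCount-functional (xs , refl , xs! , ∈xs) (ys , refl , ys! , ∈ys) =
  ↭-length (∼bag⇒↭ (unique∧set⇒bag xs! ys! (λ {x} → mk⇔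
    (Equivalence.from (∈ys x) ∘ Equivalence.to (∈xs x))
    (Equivalence.from (∈xs x) ∘ Equivalence.to (∈ys x)))))

filter-IsCount : ∀ {P : Fin n → Set} (P? : U.Decidable P) → IsCount P (length (filter P? (allFin n)))
filter-IsCount {n} P? = filter P? (allFin n) , refl , filter⁺ P? (allFin⁺ n) , λ x →
  mk⇔ (proj₂ ∘ ∈-filter⁻ P? {xs = allFin n}) (∈-filter⁺ P? (∈-allFin x))

argmin-on : ∀ {P : Fin n → Set} (f : Fin n → ℕ) → U.Decidable P → ∀ {x} → P x →
            ∃ λ y → P y × ∀ z → P z → f y ≤ f z
argmin-on {n} {P} f P? {x} px =
  argmin f x xs , argmin-all f px (All.tabulate (proj₂ ∘ ∈-filter⁻ P? {xs = allFin n})) ,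
  λ z pz → All.lookup (f[argmin]≤f[xs] x xs) (∈-filter⁺ P? (∈-allFin z) pz)
  where
  open Data.List.Extrema ℕ.≤-totalOrder
  xs = filter P? (allFin n)

sumℤ-nonneg : (g : A → ℤ) (xs : List A) → (∀ x → 0ℤ ℤ.≤ g x) → 0ℤ ℤ.≤ sumℤ (map g xs)
sumℤ-nonneg g [] _ = ℤ.≤-refl
sumℤ-nonneg g (x ∷ xs) g≥0 = ℤ.+-mono-≤ (g≥0 x) (sumℤ-nonneg g xs g≥0)

sumℤ-neg⇒∃ : (g : A → ℤ) (xs : List A) → sumℤ (map g xs) ℤ.< 0ℤ → ∃ λ x → g x ℤ.< 0ℤ
sumℤ-neg⇒∃ g [] s<0 = contradiction s<0 (ℤ.<-irrefl refl)
sumℤ-neg⇒∃ g (x ∷ xs) s<0 with g x ℤ.<? 0ℤ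
... | yes gx<0 = x , gx<0
... | no gx≮0 = sumℤ-neg⇒∃ g xs (ℤ.≤-<-trans tail≤s s<0)
  where
  tail≤s : sumℤ (map g xs) ℤ.≤ g x ℤ.+ sumℤ (map g xs)
  tail≤s = subst (ℤ._≤ g x ℤ.+ sumℤ (map g xs)) (ℤ.+-identityˡ (sumℤ (map g xs)))
                 (ℤ.+-monoˡ-≤ (sumℤ (map g xs)) (ℤ.≮⇒≥ gx≮0))

sumℤ-≤-count : ∀ {P : Pred A ℓ} (g : A → ℤ) (P? : U.Decidable P) xs →
               (∀ x → g x ℤ.≤ 0ℤ) → (∀ x → P x → g x ℤ.< 0ℤ) →
               sumℤ (map g xs) ℤ.≤ - + length (filter P? xs)
sumℤ-≤-count g P? [] _ _ = ℤ.≤-refl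
sumℤ-≤-count g P? (x ∷ xs) g≤0 P⇒g<0 with P? x
... | yes px = subst (_ ℤ.≤_) (sym (ℤ.neg-distrib-+ (+ 1) (+ _)))
                 (ℤ.+-mono-≤ (ℤ.i<j⇒i≤pred[j] (P⇒g<0 x px)) (sumℤ-≤-count g P? xs g≤0 P⇒g<0))
... | no _ = subst (_ ℤ.≤_) (ℤ.+-identityˡ _) (ℤ.+-mono-≤ (g≤0 x) (sumℤ-≤-count g P? xs g≤0 P⇒g<0))

sumℤ-≡-count : ∀ {P : Pred A ℓ} (g : A → ℤ) (P? : U.Decidable P) xs →
               (∀ x → P x → g x ≡ -1ℤ) → (∀ x → ¬ P x → g x ≡ 0ℤ) →
               sumℤ (map g xs) ≡ - + length (filter P? xs)
sumℤ-≡-count g P? [] _ _ = refl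
sumℤ-≡-count g P? (x ∷ xs) on off with P? x
... | yes px = trans (cong₂ ℤ._+_ (on x px) (sumℤ-≡-count g P? xs on off))
                     (sym (ℤ.neg-distrib-+ (+ 1) (+ _)))
... | no ¬px = trans (cong₂ ℤ._+_ (off x ¬px) (sumℤ-≡-count g P? xs on off)) (ℤ.+-identityˡ _)

indicator : Dec A → ℤ
indicator (yes _) = + 1
indicator (no _) = 0ℤ

i<j⇒i-j<0 : ∀ {i j} → i ℤ.< j → i ℤ.- j ℤ.< 0ℤ
i<j⇒i-j<0 {i} {j} i<j = ℤ.≤∧≢⇒< (ℤ.i≤j⇒i-j≤0 (ℤ.<⇒≤ i<j)) (ℤ.<⇒≢ i<j ∘ ℤ.i-j≡0⇒i≡j i j)

0<k⇒-k<0 : ∀ {k} → 0 < k → - + k ℤ.< 0ℤ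
0<k⇒-k<0 (s≤s _) = -<+

if-diff<0 : ∀ b {i j} → (if b then i ℤ.- j else 0ℤ) ℤ.< 0ℤ → T b × i ℤ.< j
if-diff<0 false 0<0 = contradiction 0<0 (ℤ.<-irrefl refl)
if-diff<0 true {i} {j} i-j<0 =
  tt , ℤ.≤∧≢⇒< (ℤ.i-j≤0⇒i≤j (ℤ.<⇒≤ i-j<0)) (ℤ.<⇒≢ i-j<0 ∘ ℤ.i≡j⇒i-j≡0)

IsMinimum : (Fin n → ℤ) → Fin n → Set
IsMinimum f Q = ∀ R → f Q ℤ.≤ f R

module _ (G : SimpleGraph n) (f : Fin n → ℤ) where

  Δ-at-minimum : ∀ {Q} {P : Fin n → Set} (P? : U.Decidable P) → IsMinimum f Q →
                 (∀ R → P R → T (adj G Q R) × f Q ℤ.< f R) →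
                 Δ G f Q ℤ.≤ - + length (filter P? (allFin n))
  Δ-at-minimum {Q} {P} P? min P⇒above = sumℤ-≤-count _ P? (allFin n) term≤0 term<0
    where
    term≤0 : ∀ R → (if adj G Q R then f Q ℤ.- f R else 0ℤ) ℤ.≤ 0ℤ
    term≤0 R with adj G Q R
    ... | true = ℤ.i≤j⇒i-j≤0 (min R)
    ... | false = ℤ.≤-refl
    term<0 : ∀ R → P R → (if adj G Q R then f Q ℤ.- f R else 0ℤ) ℤ.< 0ℤ
    term<0 R pR with adj G Q R | P⇒above R pR
    ... | true | _ , fQ<fR = i<j⇒i-j<0 fQ<fR

  minimum-spreads : ∀ {Q R} → IsMinimum f Q → 0ℤ ℤ.≤ Δ G f Q → T (adj G Q R) → f R ≡ f Q
  minimum-spreads {Q} {R} min Δ≥0 QR with f Q ℤ.<? f R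
  ... | no fQ≮fR = ℤ.≤-antisym (ℤ.≮⇒≥ fQ≮fR) (min R)
  ... | yes fQ<fR =
    contradiction (ℤ.≤-trans Δ≥0 Δ≤) (ℤ.<⇒≱ (0<k⇒-k<0 (filter-nonempty (_≟ R) (∈-allFin R) refl)))
    where
    Δ≤ : Δ G f Q ℤ.≤ - + length (filter (_≟ R) (allFin n))
    Δ≤ = Δ-at-minimum (_≟ R) min λ { _ refl → QR , fQ<fR }

adj-symT : (G : SimpleGraph n) → ∀ {x y} → T (adj G x y) → T (adj G y x)
adj-symT G {x} {y} = subst T (adj-sym G x y)

module _ (G : SimpleGraph n) (P : Fin n) where

  start≢P : ∀ {x y} → WalkAvoid G P x y → x ≢ P
  start≢P (here x≢P) = x≢P
  start≢P (step x≢P _ _) = x≢P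

  end≢P : ∀ {x y} → WalkAvoid G P x y → y ≢ P
  end≢P (here y≢P) = y≢P
  end≢P (step _ _ w) = end≢P w

  snoc : ∀ {x y z} → WalkAvoid G P x y → T (adj G y z) → z ≢ P → WalkAvoid G P x z
  snoc (here y≢P) yz z≢P = step y≢P yz (here z≢P)
  snoc (step x≢P xw w) yz z≢P = step x≢P xw (snoc w yz z≢P)

  reverse : ∀ {x y} → WalkAvoid G P x y → WalkAvoid G P y x
  reverse (here x≢P) = here x≢P
  reverse (step x≢P xw w) = snoc (reverse w) (adj-symT G xw) x≢P

  walk-to-P⇒neighbour : ∀ {Q} → Q ≢ P → Walk (adj G) Q P →
                        ∃ λ R → T (adj G P R) × WalkAvoid G P Q R
  walk-to-P⇒neighbour Q≢P here = contradiction refl Q≢P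
  walk-to-P⇒neighbour {Q} Q≢P (step {j = R} QR w) with R ≟ P
  ... | yes refl = Q , adj-symT G QR , here Q≢P
  ... | no R≢P with walk-to-P⇒neighbour R≢P w
  ...   | S , PS , w′ = S , PS , step Q≢P QR w′

  Edge : Rel (Fin n) _
  Edge x y = T (adj G x y) × y ≢ P

  toStar : ∀ {x y} → WalkAvoid G P x y → Star Edge x y
  toStar (here _) = ε
  toStar (step _ xz w) = (xz , start≢P w) ◅ toStar w

  fromStar : ∀ {x y} → x ≢ P → Star Edge x y → WalkAvoid G P x y
  fromStar x≢P ε = here x≢P
  fromStar x≢P ((xz , z≢P) ◅ w) = step x≢P xz (fromStar z≢P w)

  edge? : Decidable Edge
  edge? x y = T? (adj G x y) ×-dec ¬? (y ≟ P)

  walkAvoid? : Decidable (WalkAvoid G P)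
  walkAvoid? x y = map′ (uncurry fromStar) (λ w → start≢P w , toStar w)
    (¬? (x ≟ P) ×-dec Reachability.star? edge? x y)

  compNbr? : ∀ Q → U.Decidable (λ R → T (adj G P R) × WalkAvoid G P Q R)
  compNbr? Q R = T? (adj G P R) ×-dec walkAvoid? Q R

  deg : Fin n → ℕ
  deg Q = length (filter (compNbr? Q) (allFin n))

  deg-CompDeg : ∀ Q → CompDeg G P Q (deg Q)
  deg-CompDeg Q = filter-IsCount (compNbr? Q)

  deg≢0 : ∀ {Q} → Q ≢ P → deg Q ≢ 0
  deg≢0 {Q} Q≢P with walk-to-P⇒neighbour Q≢P (connected G Q P)
  ... | R , PR , w = ℕ.>⇒≢ (filter-nonempty (compNbr? Q) (∈-allFin R) (PR , w))

  component-indicator : Fin n → Fin n → ℤ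
  component-indicator Q R = indicator (walkAvoid? Q R)

  Δ-indicator-P : ∀ Q → Δ G (component-indicator Q) P ≡ - + deg Q
  Δ-indicator-P Q = sumℤ-≡-count _ (compNbr? Q) (allFin n) on off
    where
    on : ∀ R → T (adj G P R) × WalkAvoid G P Q R →
         (if adj G P R then indicator (walkAvoid? Q P) ℤ.- indicator (walkAvoid? Q R) else 0ℤ) ≡ -1ℤ
    on R (PR , w) with adj G P R | walkAvoid? Q P | walkAvoid? Q R
    ... | true | no _     | yes _ = refl
    ... | true | yes w′   | _     = contradiction refl (end≢P w′)
    ... | true | _        | no ¬w = contradiction w ¬w
    off : ∀ R → ¬ (T (adj G P R) × WalkAvoid G P Q R) →
          (if adj G P R then indicator (walkAvoid? Q P) ℤ.- indicator (walkAvoid? Q R) else 0ℤ) ≡ 0ℤ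
    off R ¬PR×w with adj G P R | walkAvoid? Q P | walkAvoid? Q R
    ... | false | _      | _     = refl
    ... | true  | no _   | no _  = refl
    ... | true  | yes w′ | _     = contradiction refl (end≢P w′)
    ... | true  | _      | yes w = contradiction (tt , w) ¬PR×w

  Δ-indicator-≥0 : ∀ Q Q′ → Q′ ≢ P → 0ℤ ℤ.≤ Δ G (component-indicator Q) Q′
  Δ-indicator-≥0 Q Q′ Q′≢P = sumℤ-nonneg _ (allFin n) term≥0
    where
    term≥0 : ∀ R → 0ℤ ℤ.≤
      (if adj G Q′ R then indicator (walkAvoid? Q Q′) ℤ.- indicator (walkAvoid? Q R) else 0ℤ)
    term≥0 R with adj G Q′ R in Q′R | walkAvoid? Q Q′ | walkAvoid? Q R
    ... | false | _      | _     = ℤ.≤-refl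
    ... | true  | yes _  | yes _ = ℤ.≤-refl
    ... | true  | yes _  | no _  = +≤+ z≤n
    ... | true  | no _   | no _  = ℤ.≤-refl
    ... | true  | no ¬w′ | yes w =
      contradiction (snoc w (adj-symT G (subst T (sym Q′R) tt)) Q′≢P) ¬w′

  deg∈H : ∀ Q → H G P (deg Q)
  deg∈H Q = component-indicator Q , Δ-indicator-P Q , Δ-indicator-≥0 Q

  module _ (f : Fin n → ℤ) (Δ≥0 : ∀ Q → Q ≢ P → 0ℤ ℤ.≤ Δ G f Q) where

    minimum-reaches-P : ∀ {x} → IsMinimum f x → Walk (adj G) x P → f P ≡ f x
    minimum-reaches-P min here = refl
    minimum-reaches-P {x} min (step xy w) with x ≟ P
    ... | yes refl = refl
    ... | no x≢P = trans (minimum-reaches-P (λ R → subst (ℤ._≤ f R) (sym fy≡fx) (min R)) w) fy≡fx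
      where fy≡fx = minimum-spreads G f min (Δ≥0 x x≢P) xy

    P-minimum : IsMinimum f P
    P-minimum R = subst (ℤ._≤ f R) (sym (minimum-reaches-P m-min (connected G m P))) (m-min R)
      where
      open Data.List.Extrema ℤ.≤-totalOrder
      m = argmin f P (allFin n)
      m-min : IsMinimum f m
      m-min R = All.lookup (f[argmin]≤f[xs] P (allFin n)) (∈-allFin R)

    constant-on-component : ∀ {x y} → WalkAvoid G P x y → f x ≡ f P → f y ≡ f P
    constant-on-component (here _) fx≡fP = fx≡fP
    constant-on-component (step x≢P xz w) fx≡fP =
      constant-on-component w (trans (minimum-spreads G f x-min (Δ≥0 _ x≢P) xz) fx≡fP)
      where x-min = λ R → subst (ℤ._≤ f R) (sym fx≡fP) (P-minimum R)

    Δ<0⇒Δ≤-deg : Δ G f P ℤ.< 0ℤ → ∃ λ R → R ≢ P × Δ G f P ℤ.≤ - + deg R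
    Δ<0⇒Δ≤-deg Δ<0 with sumℤ-neg⇒∃ _ (allFin n) Δ<0
    ... | R₀ , term<0 with if-diff<0 (adj G P R₀) term<0
    ...   | _ , fP<fR₀ = R₀ , R₀≢P ,
      Δ-at-minimum G f (compNbr? R₀) P-minimum λ R (PR , w) → PR , above R w
      where
      R₀≢P : R₀ ≢ P
      R₀≢P refl = ℤ.<-irrefl refl fP<fR₀
      above : ∀ R → WalkAvoid G P R₀ R → f P ℤ.< f R
      above R w = ℤ.≤∧≢⇒< (P-minimum R)
        (λ fP≡fR → ℤ.<⇒≢ fP<fR₀ (sym (constant-on-component (reverse w) (sym fP≡fR))))

another-vertex : 2 ≤ n → (P : Fin n) → ∃ λ Q → Q ≢ P
another-vertex (s≤s (s≤s _)) zero = suc zero , λ ()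
another-vertex (s≤s (s≤s _)) (suc _) = zero , λ ()

minimal-component : (G : SimpleGraph n) (P : Fin n) → 2 ≤ n →
                    ∃ λ Q → Q ≢ P × ∀ R → R ≢ P → deg G P Q ≤ deg G P R
minimal-component G P 2≤n =
  argmin-on (deg G P) (λ Q → ¬? (Q ≟ P)) (proj₂ (another-vertex 2≤n P))

module _ (G : SimpleGraph n) (P : Fin n) {Q} (Q-min : ∀ R → R ≢ P → deg G P Q ≤ deg G P R) where

  deg-isMultiplicity : Q ≢ P → IsMultiplicity (H G P) (deg G P Q)
  deg-isMultiplicity Q≢P = deg∈H G P Q , deg≢0 G P Q≢P , lower-bound
    where
    lower-bound : ∀ k → H G P k → k ≢ 0 → deg G P Q ≤ k
    lower-bound k (f , Δ≡-k , Δ≥0) k≢0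
      with Δ<0⇒Δ≤-deg G P f Δ≥0 (subst (ℤ._< 0ℤ) (sym Δ≡-k) (0<k⇒-k<0 (ℕ.n≢0⇒n>0 k≢0)))
    ... | R , R≢P , Δ≤-degR = ℕ.≤-trans (Q-min R R≢P)
      (ℤ.drop‿+≤+ (ℤ.neg-cancel-≤ (subst (ℤ._≤ - + deg G P R) Δ≡-k Δ≤-degR)))

  deg-isMinCompDeg : Q ≢ P → IsMinCompDeg G P (deg G P Q)
  deg-isMinCompDeg Q≢P = (Q , Q≢P , deg-CompDeg G P Q) , λ R e R≢P count →
    subst (deg G P Q ≤_) (IsCount-functional (deg-CompDeg G P R) count) (Q-min R R≢P)

proposition4p7 : (n : ℕ) → 2 ≤ n → (G : SimpleGraph n) → (P : Fin n) →
    Σ ℕ (λ d → IsMultiplicity (H G P) d × IsMinCompDeg G P d)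
proposition4p7 n 2≤n G P =
  let Q , Q≢P , Q-min = minimal-component G P 2≤n
  in deg G P Q , deg-isMultiplicity G P Q-min Q≢P , deg-isMinCompDeg G P Q-min Q≢P
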